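{- Let $G=K_{r_1,\ldots,r_k}$ be a complete $k$-partite graph with $r_k\ge4$ (i.e. every part has at least $4$ vertices), and let $C$ be a set of fewer than $2k-1$ colors. If, in the graph coloring game on $G$ with color set $C$, Bob plays according to strategy $(B1)$, then, whatever Alice does, the players cannot color the whole graph (the game ends with some vertex uncolored).
   Context: Graph coloring game: given a graph $G$ and a finite set $C$ of colors, Alice and Bob alternately (Alice first) pick an uncolored vertex and give it a legal color, i.e. a color from $C$ not used on any neighbor. The game ends when all vertices are colored (Alice wins) or when no uncolored vertex has a legal color (Bob wins). $K_{r_1,\ldots,r_k}$ denotes the complete $k$-partite graph with parts (independent sets) $V_1,\ldots,V_k$, $|V_i|=r_i\ge1$, $r_1\ge\cdots\ge r_k$, every two vertices in different parts adjacent; the paper assumes that if $k\ge2$ then $r_1\ge 2$. A part is uncolored / partially colored / fully colored if none / some but not all / all of its vertices are colored. A "new color" is a color of $C$ not yet used on any vertex. Strategy $(B1)$ for Bob, where $V_i$ denotes the part in which Alice just played: (1) if $V_i$ is (still) partially colored, pick any uncolored vertex of $V_i$; (2) otherwise ($V_i$ is now fully colored), if there is a partially colored part, choose a partially colored part with the smallest number of uncolored vertices and pick any uncolored vertex of it; (3) otherwise, if there is an uncolored part, pick any vertex of a largest uncolored part. Bob assigns to the chosen vertex a new color if one is available; otherwise he reuses a color already appearing on some other vertex of the part containing the chosen vertex. -}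

module Defs where

open import Data.Nat using (ℕ; zero; suc; _+_; _≤_)
open import Data.Fin using (Fin)
open import Data.Maybe using (Maybe; just; nothing; is-nothing)
open import Data.Bool using (if_then_else_)
open import Data.List using (List; map; allFin)
open import Data.Nat.ListAction using (sum)
open import Data.Sum using (_⊎_)
open import Data.Product using (Σ; _×_; _,_; proj₁; ∃; ∃-syntax)
open import Relation.Binary.PropositionalEquality using (_≡_; _≢_)
open import Relation.Nullary using (¬_)

-- The complete k-partite graph K_{r_1,...,r_k} (parts indexed by Fin k, part i has
-- r i vertices), played with the colour set Fin c.
module Game (k : ℕ) (r : Fin k → ℕ) (c : ℕ) where

  Vertex : Set
  Vertex = Σ (Fin k) (λ i → Fin (r i))

  part : Vertex → Fin k
  part = proj₁

  Coloring : Set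
  Coloring = Vertex → Maybe (Fin c)

  empty : Coloring
  empty _ = nothing

  Adjacent : Vertex → Vertex → Set
  Adjacent v w = part v ≢ part w

  Update : Coloring → Vertex → Fin c → Coloring → Set
  Update f v col f' = (f' v ≡ just col) × (∀ w → w ≢ v → f' w ≡ f w)

  Legal : Coloring → Vertex → Fin c → Set
  Legal f v col = (f v ≡ nothing) × (∀ w → Adjacent w v → f w ≢ just col)

  UncoloredPart : Coloring → Fin k → Set
  UncoloredPart f i = ∀ j → f (i , j) ≡ nothing

  PartiallyColoredPart : Coloring → Fin k → Set
  PartiallyColoredPart f i =
    (∃[ j ] f (i , j) ≡ nothing) × (∃[ j ] ∃[ col ] f (i , j) ≡ just col)

  uncoloredCount : Coloring → Fin k → ℕ
  uncoloredCount f i =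
    sum (map (λ j → if is-nothing (f (i , j)) then 1 else 0) (allFin (r i)))

  NewColor : Coloring → Fin c → Set
  NewColor f col = ∀ w → f w ≢ just col

  -- Vertex choice of strategy (B1); i is the part in which Alice just played,
  -- f is the colouring after Alice's move.
  B1Vertex : Coloring → Fin k → Vertex → Set
  B1Vertex f i v =
    (PartiallyColoredPart f i → part v ≡ i)
    × (¬ PartiallyColoredPart f i → (∃[ j ] PartiallyColoredPart f j) →
         PartiallyColoredPart f (part v)
         × (∀ j → PartiallyColoredPart f j → uncoloredCount f (part v) ≤ uncoloredCount f j))
    × (¬ PartiallyColoredPart f i → ¬ (∃[ j ] PartiallyColoredPart f j) →
         UncoloredPart f (part v) × (∀ j → UncoloredPart f j → r j ≤ r (part v)))

  B1Color : Coloring → Vertex → Fin c → Set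
  B1Color f v col =
    ((∃[ d ] NewColor f d) → NewColor f col)
    × (¬ (∃[ d ] NewColor f d) → ∃[ j ] f (part v , j) ≡ just col)

  B1Move : Coloring → Fin k → Vertex → Fin c → Set
  B1Move f i v col = Legal f v col × B1Vertex f i v × B1Color f v col

  -- BobToMove f i : f reachable with Bob to move, Alice having just played in part i.
  data AliceToMove : Coloring → Set
  data BobToMove : Coloring → Fin k → Set

  data AliceToMove where
    start : AliceToMove empty
    bobMoves : ∀ {f i v col f'} → BobToMove f i → B1Move f i v col →
               Update f v col f' → AliceToMove f'

  data BobToMove where
    aliceMoves : ∀ {f v col f'} → AliceToMove f → Legal f v col →
                 Update f v col f' → BobToMove f' (part v)

  Reachable : Coloring → Set
  Reachable f = AliceToMove f ⊎ (∃[ i ] BobToMove f i)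

{-# OPTIONS --safe #-}
module Submission where

-- Let S be the number of parts containing a coloured vertex and D the number of colours used.
-- Whenever Alice is to move, 2S ≤ D, and even 2S < D unless nothing is coloured yet or some
-- started part still has two uncoloured vertices. One move of Alice uses up at most one unit of
-- this slack, so afterwards 2S ≤ D + 1 ≤ |C| + 1 < 2k and some part is untouched. While a new
-- colour is available, Bob's new colour restores the invariant: if Alice opened a part, (B1)
-- sends him into it and, parts having at least four vertices, two of them stay uncoloured;
-- otherwise (B1) keeps him inside started parts unless the inequality is strict. Once every
-- colour is used, an untouched part stays untouched, since each of its vertices sees every colour.

open import Defs
open import Data.Nat using (ℕ; zero; suc; _+_; _*_; _≤_; _<_; z≤n; s≤s)
import Data.Nat.Properties as ℕ
open import Data.Fin using (Fin; zero; suc)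
import Data.Fin as F
import Data.Fin.Properties as FinP
open import Data.Maybe using (Maybe; just; nothing)
import Data.Maybe.Properties as MaybeP
open import Data.Bool using (if_then_else_)
open import Data.Product using (∃; ∃₂; ∃-syntax; _×_; _,_; proj₁; proj₂)
import Data.Product.Properties as ProductP
open import Data.Sum using (_⊎_; inj₁; inj₂; [_,_]′)
import Data.Sum as Sum
open import Data.List using (List; []; _∷_; length; lookup)
open import Data.List.Membership.Propositional using (_∈_; _∉_)
open import Data.List.Relation.Unary.Any using (here; there)
import Data.List.Relation.Unary.Any as Any
import Data.List.Relation.Unary.Any.Properties as AnyP
open import Function using (_∘_; id)
open import Relation.Nullary using (¬_; Dec; yes; no; does; contradiction)
open import Relation.Nullary.Decidable using (¬?; decidable-stable)
import Relation.Nullary.Decidable as Dec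
open import Relation.Unary using (Pred; Decidable; _⊆_; _∪_; ｛_｝; _≐_)
open import Relation.Binary.PropositionalEquality using (_≡_; _≢_; refl; sym; trans; cong; subst)

count : ∀ {n p} {P : Pred (Fin n) p} → Decidable P → ℕ
count {n = zero}  P? = 0
count {n = suc n} P? = (if does (P? zero) then 1 else 0) + count (P? ∘ suc)

count≤n : ∀ {n p} {P : Pred (Fin n) p} (P? : Decidable P) → count P? ≤ n
count≤n {n = zero}  P? = z≤n
count≤n {n = suc n} P? with P? zero
... | yes _ = s≤s (count≤n (P? ∘ suc))
... | no  _ = ℕ.m≤n⇒m≤1+n (count≤n (P? ∘ suc))

count-mono : ∀ {n p q} {P : Pred (Fin n) p} {Q : Pred (Fin n) q}
             (P? : Decidable P) (Q? : Decidable Q) → P ⊆ Q → count P? ≤ count Q?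
count-mono {n = zero}  P? Q? P⊆Q = z≤n
count-mono {n = suc n} P? Q? P⊆Q with P? zero | Q? zero
... | yes _  | yes _  = s≤s (count-mono (P? ∘ suc) (Q? ∘ suc) P⊆Q)
... | no  _  | yes _  = ℕ.m≤n⇒m≤1+n (count-mono (P? ∘ suc) (Q? ∘ suc) P⊆Q)
... | no  _  | no  _  = count-mono (P? ∘ suc) (Q? ∘ suc) P⊆Q
... | yes p₀ | no ¬q₀ = contradiction (P⊆Q p₀) ¬q₀

count-cong : ∀ {n p q} {P : Pred (Fin n) p} {Q : Pred (Fin n) q}
             (P? : Decidable P) (Q? : Decidable Q) → P ≐ Q → count P? ≡ count Q?
count-cong P? Q? (P⊆Q , Q⊆P) = ℕ.≤-antisym (count-mono P? Q? P⊆Q) (count-mono Q? P? Q⊆P)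

count-insert : ∀ {n p q} {P : Pred (Fin n) p} {Q : Pred (Fin n) q}
               (P? : Decidable P) (Q? : Decidable Q) {x : Fin n} →
               ¬ P x → Q ≐ P ∪ ｛ x ｝ → count Q? ≡ suc (count P?)
count-insert {n = suc n} P? Q? {zero} ¬px (Q⊆ , ⊆Q) with P? zero | Q? zero
... | yes px | _      = contradiction px ¬px
... | no  _  | no ¬qx = contradiction (⊆Q (inj₂ refl)) ¬qx
... | no  _  | yes _  = cong suc (count-cong (Q? ∘ suc) (P? ∘ suc)
                          ((λ q → [ id , (λ ()) ]′ (Q⊆ q)) , λ p → ⊆Q (inj₁ p)))
count-insert {n = suc n} P? Q? {suc x} ¬px (Q⊆ , ⊆Q)
  with P? zero | Q? zero
     | count-insert (P? ∘ suc) (Q? ∘ suc) ¬px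
         ((λ q → Sum.map₂ FinP.suc-injective (Q⊆ q)) , λ p → ⊆Q (Sum.map₂ (cong suc) p))
... | yes _  | yes _  | rest = cong suc rest
... | no  _  | no  _  | rest = rest
... | yes p₀ | no ¬q₀ | _    = contradiction (⊆Q (inj₁ p₀)) ¬q₀
... | no ¬p₀ | yes q₀ | _    = contradiction (Q⊆ q₀) [ ¬p₀ , (λ ()) ]′

count-all : ∀ {n p} {P : Pred (Fin n) p} (P? : Decidable P) → (∀ x → P x) → n ≤ count P?
count-all {n = zero}  P? all = z≤n
count-all {n = suc n} P? all with P? zero
... | yes _  = s≤s (count-all (P? ∘ suc) (all ∘ suc))
... | no ¬p₀ = contradiction (all zero) ¬p₀

count<n⇒∃¬ : ∀ {n p} {P : Pred (Fin n) p} (P? : Decidable P) → count P? < n → ∃ λ x → ¬ P x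
count<n⇒∃¬ {n = n} {P = P} P? lt = FinP.¬∀⟶∃¬ n P P? (ℕ.<⇒≱ lt ∘ count-all P?)

count-none : ∀ {n p} {P : Pred (Fin n) p} (P? : Decidable P) → (∀ x → ¬ P x) → count P? ≡ 0
count-none {n = zero}  P? none = refl
count-none {n = suc n} P? none with P? zero
... | yes p₀ = contradiction p₀ (none zero)
... | no  _  = count-none (P? ∘ suc) (none ∘ suc)

fresh : ∀ {n} (xs : List (Fin n)) → length xs < n → ∃ (_∉ xs)
fresh {n = n} xs |xs|<n = FinP.¬∀⟶∃¬ n (_∈ xs) (λ x → Any.any? (x FinP.≟_) xs) ¬all∈
  where
  ¬all∈ : ¬ (∀ x → x ∈ xs)
  ¬all∈ all∈ with FinP.pigeonhole |xs|<n (Any.index ∘ all∈)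
  ... | i , j , i<j , same-index = FinP.<-irrefl i≡j i<j
    where
    i≡j : i ≡ j
    i≡j = trans (AnyP.lookup-index (all∈ i))
            (trans (cong (lookup xs) same-index) (sym (AnyP.lookup-index (all∈ j))))

module B1Analysis (k : ℕ) (r : Fin k → ℕ) (c : ℕ) where
  open Game k r c

  ColourUsed : Coloring → Fin c → Set
  ColourUsed f a = ∃[ w ] f w ≡ just a

  Started : Coloring → Fin k → Set
  Started f i = ∃[ j ] ∃[ a ] f (i , j) ≡ just a

  _≟ᵥ_ : (v w : Vertex) → Dec (v ≡ w)
  _≟ᵥ_ = ProductP.≡-dec FinP._≟_ FinP._≟_

  colourUsed? : ∀ f → Decidable (ColourUsed f)
  colourUsed? f a =
    Dec.map′ (λ (i , j , e) → (i , j) , e) (λ ((i , j) , e) → i , j , e)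
      (FinP.any? λ i → FinP.any? λ j → MaybeP.≡-dec FinP._≟_ (f (i , j)) (just a))

  isJust? : (m : Maybe (Fin c)) → Dec (∃[ a ] m ≡ just a)
  isJust? nothing  = no λ ()
  isJust? (just a) = yes (a , refl)

  started? : ∀ f → Decidable (Started f)
  started? f i = FinP.any? λ j → isJust? (f (i , j))

  colours : Coloring → ℕ
  colours f = count (colourUsed? f)

  startedParts : Coloring → ℕ
  startedParts f = count (started? f)

  unstarted⇒uncoloured : ∀ f {i} → ¬ Started f i → UncoloredPart f i
  unstarted⇒uncoloured f {i} ¬st j with f (i , j) in e
  ... | nothing = refl
  ... | just a  = contradiction (j , a , e) ¬st

  legal-in-unstarted-part⇒new : ∀ {f v a} → ¬ Started f (part v) → Legal f v a → ¬ ColourUsed f a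
  legal-in-unstarted-part⇒new {v = v} ¬st (_ , no-clash) ((i , j) , e) with i FinP.≟ part v
  ... | yes refl = ¬st (j , _ , e)
  ... | no  i≢v  = no-clash (i , j) i≢v e

  LegalMove : Coloring → Vertex → Fin c → Coloring → Set
  LegalMove f v a f′ = Legal f v a × Update f v a f′

  module Move {f v a f′} (move : LegalMove f v a f′) where

    private
      v-uncoloured : f v ≡ nothing
      v-uncoloured = proj₁ (proj₁ move)

      v-coloured : f′ v ≡ just a
      v-coloured = proj₁ (proj₂ move)

      others-kept : ∀ w → w ≢ v → f′ w ≡ f w
      others-kept = proj₂ (proj₂ move)

    uncoloured-kept : ∀ {w} → w ≢ v → f w ≡ nothing → f′ w ≡ nothing
    uncoloured-kept {w} w≢v = trans (others-kept w w≢v)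

    coloured-kept : ∀ {w b} → f w ≡ just b → f′ w ≡ just b
    coloured-kept {w} fw≡b = trans (others-kept w w≢v) fw≡b
      where
      w≢v : w ≢ v
      w≢v refl = contradiction (trans (sym fw≡b) v-uncoloured) λ ()

    colourUsed-after : ColourUsed f′ ≐ ColourUsed f ∪ ｛ a ｝
    colourUsed-after =
      used′⇒ , [ (λ (w , e) → w , coloured-kept e) , (λ { refl → v , v-coloured }) ]′
      where
      used′⇒ : ColourUsed f′ ⊆ ColourUsed f ∪ ｛ a ｝
      used′⇒ {b} (w , f′w≡b) with a FinP.≟ b
      ... | yes a≡b = inj₂ a≡b
      ... | no  a≢b = inj₁ (w , trans (sym (others-kept w w≢v)) f′w≡b)
        where
        w≢v : w ≢ v
        w≢v refl = a≢b (MaybeP.just-injective (trans (sym v-coloured) f′w≡b))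

    started-after : Started f′ ≐ Started f ∪ ｛ part v ｝
    started-after = started′⇒ , [ (λ (j , b , e) → j , b , coloured-kept e)
                                 , (λ { refl → proj₂ v , a , v-coloured }) ]′
      where
      started′⇒ : Started f′ ⊆ Started f ∪ ｛ part v ｝
      started′⇒ {i} (j , b , f′ij≡b) with part v FinP.≟ i
      ... | yes v∈i = inj₂ v∈i
      ... | no  v∉i =
        inj₁ (j , b , trans (sym (others-kept (i , j) (v∉i ∘ sym ∘ cong part))) f′ij≡b)

    started-own-part : Started f′ (part v)
    started-own-part = proj₂ started-after (inj₂ refl)

    colours-mono : colours f ≤ colours f′
    colours-mono = count-mono (colourUsed? f) (colourUsed? f′) (proj₂ colourUsed-after ∘ inj₁)

    colours-new : ¬ ColourUsed f a → colours f′ ≡ suc (colours f)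
    colours-new new = count-insert (colourUsed? f) (colourUsed? f′) new colourUsed-after

    colours-opening : ¬ Started f (part v) → colours f′ ≡ suc (colours f)
    colours-opening ¬st = colours-new (legal-in-unstarted-part⇒new ¬st (proj₁ move))

    startedParts-new : ¬ Started f (part v) → startedParts f′ ≡ suc (startedParts f)
    startedParts-new ¬st = count-insert (started? f) (started? f′) ¬st started-after

    startedParts-old : Started f (part v) → startedParts f′ ≡ startedParts f
    startedParts-old st = count-cong (started? f′) (started? f)
      ([ id , (λ { refl → st }) ]′ ∘ proj₁ started-after , proj₂ started-after ∘ inj₁)

  Blocked : Coloring → Set
  Blocked f = (∀ a → ColourUsed f a) × ∃[ i ] ¬ Started f i

  blocked-move : ∀ {f v a f′} → Blocked f → LegalMove f v a f′ → Blocked f′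
  blocked-move {v = v} {a} {f′} (all-used , i , ¬st) move =
    (λ b → proj₂ (Move.colourUsed-after move) (inj₁ (all-used b))) , i , ¬st′
    where
    ¬st′ : ¬ Started f′ i
    ¬st′ st′ with proj₁ (Move.started-after move) st′
    ... | inj₁ st   = ¬st st
    ... | inj₂ refl = legal-in-unstarted-part⇒new ¬st (proj₁ move) (all-used a)

  TwoUncoloured : Coloring → Fin k → Set
  TwoUncoloured f i = ∃₂ λ x y → x ≢ y × f (i , x) ≡ nothing × f (i , y) ≡ nothing

  RoomyStartedPart : Coloring → Set
  RoomyStartedPart f = ∃[ i ] Started f i × TwoUncoloured f i

  Invariant : Coloring → Set
  Invariant f = 2 * startedParts f ≤ colours f
              × (suc (2 * startedParts f) ≤ colours f ⊎ (∀ w → f w ≡ nothing) ⊎ RoomyStartedPart f)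

  invariant-empty : Invariant empty
  invariant-empty =
    subst (λ s → 2 * s ≤ colours empty) (sym no-parts) z≤n , inj₂ (inj₁ λ _ → refl)
    where
    no-parts : startedParts empty ≡ 0
    no-parts = count-none (started? empty) λ { _ (_ , _ , ()) }

  alice-move-bound : ∀ {f v a f′} → Invariant f → LegalMove f v a f′ →
                     2 * startedParts f′ ≤ suc (colours f′)
  alice-move-bound {f} {v} {f′ = f′} (balanced , _) move with started? f (part v)
  ... | yes st = begin
    2 * startedParts f′  ≡⟨ cong (2 *_) (Move.startedParts-old move st) ⟩
    2 * startedParts f   ≤⟨ balanced ⟩
    colours f            ≤⟨ Move.colours-mono move ⟩
    colours f′           ≤⟨ ℕ.n≤1+n _ ⟩
    suc (colours f′)     ∎
    where open ℕ.≤-Reasoning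
  ... | no ¬st = begin
    2 * startedParts f′       ≡⟨ cong (2 *_) (Move.startedParts-new move ¬st) ⟩
    2 * suc (startedParts f)  ≡⟨ ℕ.*-suc 2 _ ⟩
    2 + 2 * startedParts f    ≤⟨ s≤s (s≤s balanced) ⟩
    2 + colours f             ≡⟨ cong suc (Move.colours-opening move ¬st) ⟨
    suc (colours f′)          ∎
    where open ℕ.≤-Reasoning

  partial-after-move : ∀ {f v a f′ i} → Started f i → TwoUncoloured f i → LegalMove f v a f′ →
                       PartiallyColoredPart f′ i
  partial-after-move {v = v} {f′ = f′} {i} st (x , y , x≢y , fx , fy) move =
    survivor , proj₂ (Move.started-after move) (inj₁ st)
    where
    survivor : ∃[ j ] f′ (i , j) ≡ nothing
    survivor with (i , x) ≟ᵥ v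
    ... | no  x≢v  = x , Move.uncoloured-kept move x≢v fx
    ... | yes refl = y , Move.uncoloured-kept move (λ { refl → x≢y refl }) fy

  b1-stays-in-started-parts : ∀ {f i w} → Started f i → ∃ (PartiallyColoredPart f) →
                              B1Vertex f i w → Started f (part w)
  b1-stays-in-started-parts {f} {i} {w} st partial (rule1 , rule2 , _) with started? f (part w)
  ... | yes st-w = st-w
  ... | no ¬st-w = contradiction (proj₂ (proj₁ (rule2 ¬partial-i partial))) ¬st-w
    where
    ¬partial-i : ¬ PartiallyColoredPart f i
    ¬partial-i partial-i = ¬st-w (subst (Started f) (sym (rule1 partial-i)) st)

  roomy-after-second-move : ∀ {g i j₁ j₂ b g′} → 4 ≤ r i →
                            (∀ j → j ≢ j₁ → g (i , j) ≡ nothing) →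
                            LegalMove g (i , j₂) b g′ → RoomyStartedPart g′
  roomy-after-second-move {i = i} {j₁} {j₂} {g′ = g′} 4≤r uncoloured move
    with fresh (j₁ ∷ j₂ ∷ []) (ℕ.≤-trans (ℕ.n≤1+n 3) 4≤r)
  ... | x , x∉ with fresh (j₁ ∷ j₂ ∷ x ∷ []) 4≤r
  ... | y , y∉ = i , Move.started-own-part move , x , y , y∉ ∘ there ∘ there ∘ here ∘ sym
                 , kept (x∉ ∘ here) (x∉ ∘ there ∘ here)
                 , kept (y∉ ∘ here) (y∉ ∘ there ∘ here)
    where
    kept : ∀ {z} → z ≢ j₁ → z ≢ j₂ → g′ (i , z) ≡ nothing
    kept z≢j₁ z≢j₂ = Move.uncoloured-kept move (λ { refl → z≢j₂ refl }) (uncoloured _ z≢j₁)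

  opened-part-partial : ∀ {f v a f′} → 2 ≤ r (part v) → ¬ Started f (part v) →
                        LegalMove f v a f′ → PartiallyColoredPart f′ (part v)
  opened-part-partial {f} {i , jv} 2≤r ¬st move with fresh (jv ∷ []) 2≤r
  ... | x , x∉ =
    (x , Move.uncoloured-kept move (λ { refl → x∉ (here refl) }) (unstarted⇒uncoloured f ¬st x))
    , Move.started-own-part move

  strict-before-opening : ∀ {f v a f′ w} → Invariant f → Started f (part v) → LegalMove f v a f′ →
                          B1Vertex f′ (part v) w → ¬ Started f′ (part w) →
                          suc (2 * startedParts f) ≤ colours f
  strict-before-opening (_ , inj₁ strict) _ _ _ _ = strict
  strict-before-opening (_ , inj₂ (inj₁ all-uncoloured)) (_ , _ , e) _ _ _ =
    contradiction (trans (sym e) (all-uncoloured _)) λ ()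
  strict-before-opening {f′ = f′} {w} (_ , inj₂ (inj₂ (p , st-p , two))) _ move bob ¬st-w =
    contradiction (b1-stays-in-started-parts {f′} {w = w} (Move.started-own-part move)
                     (p , partial-after-move st-p two move) bob)
                  ¬st-w

  b1-colour-new : ∀ {f v b d} → B1Color f v b → ¬ ColourUsed f d → ¬ ColourUsed f b
  b1-colour-new (new-if-possible , _) unused (w , e) = new-if-possible (_ , λ w e → unused (w , e)) w e

  module _ (four≤r : ∀ i → 4 ≤ r i) (few-colours : suc c < 2 * k) where

    bob-after-opening : ∀ {f v a f′ w b f″} → Invariant f → ¬ Started f (part v) →
                        LegalMove f v a f′ → B1Vertex f′ (part v) w →
                        ¬ ColourUsed f′ b → LegalMove f′ w b f″ → Invariant f″
    bob-after-opening {f} {i , jv} {f′ = f′} {iw , _} {f″ = f″}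
                      (balanced , _) ¬st move (rule1 , _) new move′
      with rule1 (opened-part-partial (ℕ.≤-trans (s≤s (s≤s z≤n)) (four≤r i)) ¬st move)
    ... | refl = balanced″ , inj₂ (inj₂ (roomy-after-second-move (four≤r i) uncoloured move′))
      where
      uncoloured : ∀ j → j ≢ jv → f′ (i , j) ≡ nothing
      uncoloured j j≢jv =
        Move.uncoloured-kept move (λ { refl → j≢jv refl }) (unstarted⇒uncoloured f ¬st j)
      balanced″ : 2 * startedParts f″ ≤ colours f″
      balanced″ = begin
        2 * startedParts f″       ≡⟨ cong (2 *_) (Move.startedParts-old move′ (Move.started-own-part move)) ⟩
        2 * startedParts f′       ≡⟨ cong (2 *_) (Move.startedParts-new move ¬st) ⟩
        2 * suc (startedParts f)  ≡⟨ ℕ.*-suc 2 _ ⟩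
        2 + 2 * startedParts f    ≤⟨ s≤s (s≤s balanced) ⟩
        2 + colours f             ≡⟨ cong suc (Move.colours-opening move ¬st) ⟨
        suc (colours f′)          ≡⟨ Move.colours-new move′ new ⟨
        colours f″                ∎
        where open ℕ.≤-Reasoning

    bob-after-continuation : ∀ {f v a f′ w b f″} → Invariant f → Started f (part v) →
                             LegalMove f v a f′ → B1Vertex f′ (part v) w →
                             ¬ ColourUsed f′ b → LegalMove f′ w b f″ → Invariant f″
    bob-after-continuation {f} {v} {f′ = f′} {w} {f″ = f″} inv st move bob new move′
      with started? f′ (part w)
    ... | yes st-w = ℕ.<⇒≤ strict″ , inj₁ strict″
      where
      strict″ : suc (2 * startedParts f″) ≤ colours f″
      strict″ = begin
        suc (2 * startedParts f″)  ≡⟨ cong (λ s → suc (2 * s)) (Move.startedParts-old move′ st-w) ⟩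
        suc (2 * startedParts f′)  ≡⟨ cong (λ s → suc (2 * s)) (Move.startedParts-old move st) ⟩
        suc (2 * startedParts f)   ≤⟨ s≤s (proj₁ inv) ⟩
        suc (colours f)            ≤⟨ s≤s (Move.colours-mono move) ⟩
        suc (colours f′)           ≡⟨ Move.colours-new move′ new ⟨
        colours f″                 ∎
        where open ℕ.≤-Reasoning
    ... | no ¬st-w = balanced″ , inj₂ (inj₂ roomy)
      where
      roomy : RoomyStartedPart f″
      roomy = roomy-after-second-move {j₁ = proj₂ w} (four≤r (part w))
                (λ j _ → unstarted⇒uncoloured f′ ¬st-w j) move′
      balanced″ : 2 * startedParts f″ ≤ colours f″
      balanced″ = begin
        2 * startedParts f″       ≡⟨ cong (2 *_) (Move.startedParts-new move′ ¬st-w) ⟩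
        2 * suc (startedParts f′) ≡⟨ cong ((2 *_) ∘ suc) (Move.startedParts-old move st) ⟩
        2 * suc (startedParts f)  ≡⟨ ℕ.*-suc 2 _ ⟩
        2 + 2 * startedParts f    ≤⟨ s≤s (strict-before-opening {f′ = f′} {w} inv st move bob ¬st-w) ⟩
        suc (colours f)           ≤⟨ s≤s (Move.colours-mono move) ⟩
        suc (colours f′)          ≡⟨ Move.colours-new move′ new ⟨
        colours f″                ∎
        where open ℕ.≤-Reasoning

    some-part-unstarted : ∀ {f} → 2 * startedParts f ≤ suc (colours f) → ∃[ i ] ¬ Started f i
    some-part-unstarted {f} bound = count<n⇒∃¬ (started? f) (ℕ.*-cancelˡ-< 2 _ _ (begin-strict
      2 * startedParts f  ≤⟨ bound ⟩
      suc (colours f)     ≤⟨ s≤s (count≤n (colourUsed? f)) ⟩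
      suc c               <⟨ few-colours ⟩
      2 * k               ∎))
      where open ℕ.≤-Reasoning

    bob-step : ∀ {f v a f′ w b f″} → Invariant f → LegalMove f v a f′ →
               B1Move f′ (part v) w b → Update f′ w b f″ → Invariant f″ ⊎ Blocked f″
    bob-step {f} {v} {f′ = f′} {w} inv move (legal′ , bob , colour) upd′
      with FinP.any? (λ d → ¬? (colourUsed? f′ d))
    ... | no none = inj₂ (blocked-move (all-used , some-part-unstarted (alice-move-bound inv move))
                                       (legal′ , upd′))
      where
      all-used : ∀ d → ColourUsed f′ d
      all-used d = decidable-stable (colourUsed? f′ d) (λ unused → none (d , unused))
    ... | yes (_ , unused) with started? f (part v) | b1-colour-new {v = w} colour unused
    ...   | yes st | new = inj₁ (bob-after-continuation inv st move bob new (legal′ , upd′))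
    ...   | no ¬st | new = inj₁ (bob-after-opening inv ¬st move bob new (legal′ , upd′))

    alice-to-move-invariant : ∀ {f} → AliceToMove f → Invariant f ⊎ Blocked f
    alice-to-move-invariant start = inj₁ invariant-empty
    alice-to-move-invariant (bobMoves (aliceMoves reach legal upd) bob upd′)
      with alice-to-move-invariant reach
    ... | inj₁ inv     = bob-step inv (legal , upd) bob upd′
    ... | inj₂ blocked = inj₂ (blocked-move (blocked-move blocked (legal , upd)) (proj₁ bob , upd′))

    reachable⇒unstarted-part : ∀ {f} → Reachable f → ∃[ i ] ¬ Started f i
    reachable⇒unstarted-part (inj₁ reach) with alice-to-move-invariant reach
    ... | inj₁ (balanced , _)  = some-part-unstarted (ℕ.m≤n⇒m≤1+n balanced)
    ... | inj₂ (_ , unstarted) = unstarted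
    reachable⇒unstarted-part (inj₂ (_ , aliceMoves reach legal upd)) with alice-to-move-invariant reach
    ... | inj₁ inv     = some-part-unstarted (alice-move-bound inv (legal , upd))
    ... | inj₂ blocked = proj₂ (blocked-move blocked (legal , upd))

    reachable⇒uncoloured : ∀ f → Reachable f → ∃[ v ] f v ≡ nothing
    reachable⇒uncoloured f reach with reachable⇒unstarted-part reach
    ... | i , ¬st = (i , first) , unstarted⇒uncoloured f ¬st first
      where
      first : Fin (r i)
      first = F.fromℕ< (ℕ.≤-trans (s≤s z≤n) (four≤r i))

lemma5 : (k : ℕ) (r : Fin k → ℕ) (c : ℕ) →
         (∀ i j → i F.≤ j → r j ≤ r i) →
         (∀ i → 4 ≤ r i) →
         suc c < 2 * k →
         ∀ f → Game.Reachable k r c f →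
         ∃[ v ] f v ≡ nothing
-- The ordering of the part sizes only matters for rule (3) of (B1), which the argument never uses.
lemma5 k r c _ = B1Analysis.reachable⇒uncoloured k r c
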